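{- Let $n\ge 2$. If $G$ is an $n$-vertex $2$-tree and $T(G)$ denotes its number of spanning trees, then $2^{n-2}\le T(G)\le 3^{n-2}$.
   Context: A $2$-tree is a graph obtained from the graph consisting of two adjacent vertices by iteratively adding one new vertex whose neighborhood consists of two adjacent vertices. -}

module Defs where

open import Data.Nat using (ℕ; zero; suc; _<ᵇ_; _≡ᵇ_)
open import Data.Bool using (Bool; true; false; _∧_; _∨_; not)
open import Data.Fin using (Fin; zero; suc; toℕ)
open import Data.Fin.Properties using (_≟_)
open import Data.Product using (_×_; _,_; Σ)
open import Data.List using (List; []; _∷_; length; filterᵇ; allFin; concatMap; map; _++_)
open import Relation.Nullary using (does)
open import Relation.Binary.PropositionalEquality using (_≡_)
open import Function.Bundles using (_↔_; Inverse)
open import Function.Base using (_∘_)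
open import Data.Bool.ListAction using (any; all)

-- Simple graphs on the vertex set Fin n, given by a Boolean adjacency
-- relation.  (All graphs built below are symmetric and loopless.)

Graph : ℕ → Set
Graph n = Fin n → Fin n → Bool

_==_ : ∀ {n} → Fin n → Fin n → Bool
x == y = does (x ≟ y)

K₂ : Graph 2
K₂ x y = not (x == y)

-- add a new vertex (numbered zero; old vertices are shifted by suc)
-- adjacent exactly to u and v
addVertex : ∀ {n} → Graph n → Fin n → Fin n → Graph (suc n)
addVertex G u v zero    zero    = false
addVertex G u v zero    (suc y) = (y == u) ∨ (y == v)
addVertex G u v (suc x) zero    = (x == u) ∨ (x == v)
addVertex G u v (suc x) (suc y) = G x y

-- 2-trees: graphs obtained from K₂ by iteratively adding a vertex whose
-- neighbourhood is two adjacent vertices; closed under relabelling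
-- (graph isomorphism), since "being a 2-tree" is a property of the
-- abstract graph.
data TwoTree : (n : ℕ) → Graph n → Set where
  base   : TwoTree 2 K₂
  extend : ∀ {n G} → TwoTree n G → (u v : Fin n) → G u v ≡ true →
           TwoTree (suc n) (addVertex G u v)
  relabel : ∀ {n G} → TwoTree n G → (H : Graph n) → (σ : Fin n ↔ Fin n) →
            (∀ x y → H x y ≡ G (Inverse.to σ x) (Inverse.to σ y)) → TwoTree n H

Edge : ℕ → Set
Edge n = Fin n × Fin n

edges : ∀ {n} → Graph n → List (Edge n)
edges {n} G =
  concatMap (λ i → filterᵇ (λ e → ok e) (map (λ j → i , j) (allFin n))) (allFin n)
  where
  ok : Edge n → Bool
  ok (i , j) = (toℕ i <ᵇ toℕ j) ∧ G i j

-- all sub-lists (= all subsets of a list of distinct elements)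
subsets : ∀ {A : Set} → List A → List (List A)
subsets []       = [] ∷ []
subsets (x ∷ xs) = let r = subsets xs in map (x ∷_) r ++ r

graphOf : ∀ {n} → List (Edge n) → Graph n
graphOf S x y = any (λ { (a , b) → ((a == x) ∧ (b == y)) ∨ ((a == y) ∧ (b == x)) }) S

step : ∀ {n} → Graph n → (Fin n → Bool) → (Fin n → Bool)
step {n} G R y = R y ∨ any (λ x → R x ∧ G x y) (allFin n)

iter : ∀ {A : Set} → ℕ → (A → A) → A → A
iter zero    f a = a
iter (suc k) f a = f (iter k f a)

-- y is reachable from x in G (walks of length < n suffice)
reachable : ∀ {n} → Graph n → Fin n → Fin n → Bool
reachable {n} G x y = iter n (step G) (λ z → z == x) y

connected : ∀ {n} → Graph n → Bool
connected {n} G = all (λ x → all (λ y → reachable G x y) (allFin n)) (allFin n)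

isSpanningTree : ∀ n → List (Edge n) → Bool
isSpanningTree zero    S = false
isSpanningTree (suc m) S = connected (graphOf S) ∧ (length S ≡ᵇ m)

numSpanningTrees : ∀ {n} → Graph n → ℕ
numSpanningTrees {n} G = length (filterᵇ (isSpanningTree n) (subsets (edges G)))

-- Relabelling does not change the number τ of spanning trees, and τ(K₂) = 1, so it suffices to show
-- 2 τ(G) ≤ τ(G′) ≤ 3 τ(G) when G′ arises from G by a new vertex w adjacent to the ends of an edge uv.
-- A spanning tree of G extends to one of G′ by the edge wu or by the edge wv, giving 2 τ(G) distinct trees.
-- Conversely, a spanning tree of G′ contains wu, wv or both; contracting w into one of these neighbours
-- yields a spanning tree of G, and the tree of G′ is recovered from this contraction together with which
-- of wu, wv it contains, because a tree never contains the triangle wuv. Throughout, a spanning tree is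
-- recognised as a connected set of n − 1 edges: a connected graph on n vertices has at least n − 1 edges.

module Submission where

open import Defs
open import Data.Bool using (Bool; true; false; T; _∧_; _∨_; if_then_else_)
open import Data.Bool.ListAction using (any)
open import Data.Bool.Properties using (T-∨; T-∧; T-≡; T?)
open import Data.Empty using (⊥; ⊥-elim)
open import Data.Fin using (Fin; zero; suc; toℕ)
open import Data.Fin.Properties using (_≟_; injective⇒≤; toℕ-injective; toℕ<n)
  renaming (suc-injective to Fin-suc-injective)
open import Data.List using (List; []; _∷_; length; map; filter; filterᵇ; allFin; concatMap; lookup; cartesianProduct)
open import Data.List.Membership.Propositional using (_∈_; _∉_; find; lose)
open import Data.List.Membership.Propositional.Properties
  using (∈-map⁺; ∈-map⁻; ∈-++⁺ˡ; ∈-++⁺ʳ; ∈-++⁻; ∈-lookup; ∈-allFin; ∈-concat⁻′; ∈-concatMap⁺; ∈-concatMap⁻;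
         ∈-filter⁺; ∈-filter⁻; ∈-cartesianProduct⁺; ∈-cartesianProduct⁻)
open import Data.List.Properties using (∷-injectiveʳ; length-map; length-++; length-tabulate; filter-notAll)
open import Data.List.Relation.Binary.Subset.Propositional using (_⊆_)
import Data.List.Relation.Unary.All as All
open import Data.List.Relation.Unary.All.Properties using (all⁺; all⁻)
open import Data.List.Relation.Unary.AllPairs using ([]; _∷_)
open import Data.List.Relation.Unary.Any using (here; there; index)
import Data.List.Relation.Unary.Any as Any
open import Data.List.Relation.Unary.Any.Properties using (lookup-index; any⁺; any⁻)
open import Data.List.Relation.Unary.Unique.Propositional using (Unique)
import Data.List.Relation.Unary.Unique.Propositional.Properties as Unique
open import Data.Nat using (ℕ; zero; suc; _≤_; _<_; _^_; _∸_; _*_; _+_; z≤n; s≤s; s≤s⁻¹)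
open import Data.Nat.Properties
  using (≤-antisym; ≤-trans; ≤-reflexive; <-irrefl; <-asym; <-cmp; <⇒≤; <⇒≱; n<1+n; m<n⇒m<1+n; m≤n⇒m≤1+n;
         m≤n⇒m<n∨m≡n; *-monoʳ-≤; <ᵇ⇒<; <⇒<ᵇ; ≡ᵇ⇒≡; ≡⇒≡ᵇ)
open import Data.Product using (∃; ∃-syntax; _×_; _,_; proj₁; proj₂; swap; uncurry)
open import Data.Product.Properties using (≡-dec)
open import Data.Sum using (_⊎_; inj₁; inj₂)
open import Data.Unit using (tt)
open import Function.Base using (id; _∘_)
open import Function.Bundles using (Equivalence; Inverse; _↔_)
open import Function.Construct.Symmetry using (↔-sym)
open import Relation.Binary using (tri<; tri≈; tri>)
open import Relation.Binary.Construct.Closure.ReflexiveTransitive using (Star; ε; _◅_; _◅◅_; gmap; kleisliStar; reverse)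
open import Relation.Binary.Definitions using (Symmetric)
open import Relation.Binary.PropositionalEquality using (_≡_; _≢_; refl; sym; trans; cong; cong₂; subst; subst₂)
open import Relation.Nullary using (¬_; ¬?; Dec; yes; no; does)
open import Relation.Unary using (Decidable)

private
  variable
    A B : Set
    x y : A
    xs ys S S₁ S₂ : List A
    n m : ℕ

-- Counting by injections

lookup-injective : Unique xs → ∀ {i j} → lookup xs i ≡ lookup xs j → i ≡ j
lookup-injective (_  ∷ _) {zero}  {zero}  _  = refl
lookup-injective (x≢ ∷ _) {zero}  {suc j} eq = ⊥-elim (All.lookup x≢ (∈-lookup j) eq)
lookup-injective (x≢ ∷ _) {suc i} {zero}  eq = ⊥-elim (All.lookup x≢ (∈-lookup i) (sym eq))
lookup-injective (_  ∷ u) {suc i} {suc j} eq = cong suc (lookup-injective u eq)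

matching⇒length≤ : (R : A → B → Set) → Unique xs →
  (∀ {x} → x ∈ xs → ∃[ y ] y ∈ ys × R x y) →
  (∀ {x x′ y} → x ∈ xs → x′ ∈ xs → R x y → R x′ y → x ≡ x′) →
  length xs ≤ length ys
matching⇒length≤ {xs = xs} {ys = ys} R u match R-injective = injective⇒≤ g-injective
  where
  partner : ∀ i → ∃[ y ] y ∈ ys × R (lookup xs i) y
  partner i = match (∈-lookup i)

  g : Fin (length xs) → Fin (length ys)
  g i = index (proj₁ (proj₂ (partner i)))

  partner≡ : ∀ i → proj₁ (partner i) ≡ lookup ys (g i)
  partner≡ i = lookup-index (proj₁ (proj₂ (partner i)))

  g-injective : ∀ {i j} → g i ≡ g j → i ≡ j
  g-injective {i} {j} gi≡gj = lookup-injective u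
    (R-injective (∈-lookup i) (∈-lookup j) (proj₂ (proj₂ (partner i)))
      (subst (R (lookup xs j)) (trans (partner≡ j) (trans (cong (lookup ys) (sym gi≡gj)) (sym (partner≡ i))))
        (proj₂ (proj₂ (partner j)))))

injection⇒length≤ : (f : A → B) → Unique xs → (∀ {x} → x ∈ xs → f x ∈ ys) →
  (∀ {x x′} → x ∈ xs → x′ ∈ xs → f x ≡ f x′ → x ≡ x′) → length xs ≤ length ys
injection⇒length≤ f u f∈ f-injective =
  matching⇒length≤ (λ x y → f x ≡ y) u (λ x∈ → _ , f∈ x∈ , refl)
    (λ x∈ x′∈ fx≡y fx′≡y → f-injective x∈ x′∈ (trans fx≡y (sym fx′≡y)))

length-cartesianProduct : (xs : List A) (ys : List B) →
  length (cartesianProduct xs ys) ≡ length xs * length ys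
length-cartesianProduct []       ys = refl
length-cartesianProduct (x ∷ xs) ys = trans (length-++ (map (x ,_) ys))
  (cong₂ _+_ (length-map (x ,_) ys) (length-cartesianProduct xs ys))

∈-map-injective⁻ : {f : A → B} → (∀ {x x′} → f x ≡ f x′ → x ≡ x′) → f x ∈ map f xs → x ∈ xs
∈-map-injective⁻ f-injective fx∈ with _ , x′∈ , fx≡fx′ ← ∈-map⁻ _ fx∈ = subst (_∈ _) (sym (f-injective fx≡fx′)) x′∈

concatMap-unique : (key : B → A) {f : A → List B} → Unique xs → (∀ x → Unique (f x)) →
  (∀ {x b} → b ∈ f x → key b ≡ x) → Unique (concatMap f xs)
concatMap-unique key []          _    _    = []
concatMap-unique {xs = x ∷ xs} key {f} (x≢ ∷ u) f-unique key≡ =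
  Unique.++⁺ (f-unique x) (concatMap-unique key u f-unique key≡) disjoint
  where
  disjoint : ∀ {b} → ¬ (b ∈ f x × b ∈ concatMap f xs)
  disjoint (b∈fx , b∈rest) with _ , b∈fx′ , fx′∈ ← ∈-concat⁻′ (map f xs) b∈rest
                           with x′ , x′∈ , refl ← ∈-map⁻ f fx′∈ =
    All.lookup x≢ x′∈ (trans (sym (key≡ b∈fx)) (key≡ b∈fx′))

∈-subsets-∷⁻ : S ∈ subsets (x ∷ xs) → (∃[ s ] S ≡ x ∷ s × s ∈ subsets xs) ⊎ S ∈ subsets xs
∈-subsets-∷⁻ {x = x} {xs} S∈ with ∈-++⁻ (map (x ∷_) (subsets xs)) S∈
... | inj₁ S∈₁ with s , s∈ , S≡ ← ∈-map⁻ (x ∷_) S∈₁ = inj₁ (s , S≡ , s∈)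
... | inj₂ S∈₂ = inj₂ S∈₂

∈-subsets⇒⊆ : S ∈ subsets xs → S ⊆ xs
∈-subsets⇒⊆ {xs = []} (here refl) ()
∈-subsets⇒⊆ {xs = x ∷ xs} S∈ y∈ with ∈-subsets-∷⁻ {x = x} {xs = xs} S∈
∈-subsets⇒⊆ {xs = x ∷ xs} S∈ (here refl) | inj₁ (s , refl , s∈) = here refl
∈-subsets⇒⊆ {xs = x ∷ xs} S∈ (there y∈) | inj₁ (s , refl , s∈) = there (∈-subsets⇒⊆ s∈ y∈)
∈-subsets⇒⊆ {xs = x ∷ xs} S∈ y∈         | inj₂ S∈′ = there (∈-subsets⇒⊆ S∈′ y∈)

filter-∈-subsets : {P : A → Set} (P? : Decidable P) (xs : List A) → filter P? xs ∈ subsets xs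
filter-∈-subsets P? []       = here refl
filter-∈-subsets P? (x ∷ xs) with does (P? x)
... | true  = ∈-++⁺ˡ (∈-map⁺ (x ∷_) (filter-∈-subsets P? xs))
... | false = ∈-++⁺ʳ (map (x ∷_) (subsets xs)) (filter-∈-subsets P? xs)

subsets-unique : Unique xs → Unique (subsets xs)
subsets-unique {xs = []} [] = All.[] ∷ []
subsets-unique {xs = x ∷ xs} (x≢ ∷ u) =
  Unique.++⁺ (Unique.map⁺ ∷-injectiveʳ (subsets-unique u)) (subsets-unique u) disjoint
  where
  disjoint : ∀ {S} → ¬ (S ∈ map (x ∷_) (subsets xs) × S ∈ subsets xs)
  disjoint (S∈₁ , S∈₂) with s , _ , refl ← ∈-map⁻ (x ∷_) S∈₁ =
    All.lookup x≢ (∈-subsets⇒⊆ S∈₂ (here refl)) refl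

∈-subsets-≡ : Unique xs → S₁ ∈ subsets xs → S₂ ∈ subsets xs → S₁ ⊆ S₂ → S₂ ⊆ S₁ → S₁ ≡ S₂
∈-subsets-≡ {xs = []} _ (here refl) (here refl) _ _ = refl
∈-subsets-≡ {xs = x ∷ xs} (x≢ ∷ u) S₁∈ S₂∈ S₁⊆S₂ S₂⊆S₁
  with ∈-subsets-∷⁻ {x = x} {xs = xs} S₁∈ | ∈-subsets-∷⁻ {x = x} {xs = xs} S₂∈
... | inj₁ (s₁ , refl , s₁∈) | inj₁ (s₂ , refl , s₂∈) =
  cong (x ∷_) (∈-subsets-≡ u s₁∈ s₂∈ (drop-x s₁∈ S₁⊆S₂) (drop-x s₂∈ S₂⊆S₁))
  where
  x∉ : x ∉ xs
  x∉ x∈ = All.lookup x≢ x∈ refl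
  drop-x : ∀ {s t} → s ∈ subsets xs → x ∷ s ⊆ x ∷ t → s ⊆ t
  drop-x s∈ ⊆ y∈ with ⊆ (there y∈)
  ... | here refl = ⊥-elim (x∉ (∈-subsets⇒⊆ s∈ y∈))
  ... | there y∈t = y∈t
... | inj₁ (s₁ , refl , _) | inj₂ S₂∈′ = ⊥-elim (All.lookup x≢ (∈-subsets⇒⊆ S₂∈′ (S₁⊆S₂ (here refl))) refl)
... | inj₂ S₁∈′ | inj₁ (s₂ , refl , _) = ⊥-elim (All.lookup x≢ (∈-subsets⇒⊆ S₁∈′ (S₂⊆S₁ (here refl))) refl)
... | inj₂ S₁∈′ | inj₂ S₂∈′ = ∈-subsets-≡ u S₁∈′ S₂∈′ S₁⊆S₂ S₂⊆S₁

∈-filterᵇ⁻ : (p : A → Bool) → x ∈ filterᵇ p xs → x ∈ xs × T (p x)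
∈-filterᵇ⁻ p = ∈-filter⁻ (T? ∘ p)

∈-filterᵇ⁺ : (p : A → Bool) → x ∈ xs → T (p x) → x ∈ filterᵇ p xs
∈-filterᵇ⁺ p = ∈-filter⁺ (T? ∘ p)

T-∨ˡ : ∀ {a} b → T a → T (a ∨ b)
T-∨ˡ {true} _ _ = tt

T-∨ʳ : ∀ a {b} → T b → T (a ∨ b)
T-∨ʳ true  _ = tt
T-∨ʳ false t = t

T-does⁻ : (a? : Dec A) → T (does a?) → A
T-does⁻ (yes a) _ = a

T-does⁺ : (a? : Dec A) → A → T (does a?)
T-does⁺ (yes _)  _ = tt
T-does⁺ (no ¬a) a = ¬a a

==⇒≡ : {x y : Fin n} → T (x == y) → x ≡ y
==⇒≡ = T-does⁻ (_ ≟ _)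

≡⇒== : {x y : Fin n} → x ≡ y → T (x == y)
≡⇒== = T-does⁺ (_ ≟ _)

Adj : Graph n → Fin n → Fin n → Set
Adj G x y = T (G x y)

Loopless : Graph n → Set
Loopless G = ∀ {x} → ¬ Adj G x x

∈-edges⁻ : {G : Graph n} {i j : Fin n} → (i , j) ∈ edges G → toℕ i < toℕ j × Adj G i j
∈-edges⁻ {n} e∈ with i′ , _ , e∈row ← find (∈-concatMap⁻ _ {xs = allFin n} e∈) =
  let _ , ok = ∈-filterᵇ⁻ {xs = map (i′ ,_) (allFin n)} _ e∈row
      i<j , a = Equivalence.to T-∧ ok
  in <ᵇ⇒< _ _ i<j , a

∈-edges⁺ : {G : Graph n} {i j : Fin n} → toℕ i < toℕ j → Adj G i j → (i , j) ∈ edges G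
∈-edges⁺ {n} {i = i} {j} i<j a =
  ∈-concatMap⁺ _ (lose (∈-allFin i) (∈-filterᵇ⁺ _ (∈-map⁺ (i ,_) (∈-allFin j)) (Equivalence.from T-∧ (<⇒<ᵇ i<j , a))))

edges-unique : (G : Graph n) → Unique (edges G)
edges-unique {n} G = concatMap-unique proj₁ (Unique.allFin⁺ n)
  (λ i → Unique.filter⁺ _ (Unique.map⁺ (cong proj₂) (Unique.allFin⁺ n)))
  (λ {i} e∈ → let _ , _ , e≡ = ∈-map⁻ (i ,_) (proj₁ (∈-filterᵇ⁻ {xs = map (i ,_) (allFin n)} _ e∈)) in cong proj₁ e≡)

edges-swap∉ : {G : Graph n} {i j : Fin n} → (i , j) ∈ edges G → (j , i) ∉ edges G
edges-swap∉ ij∈ ji∈ = <-asym (proj₁ (∈-edges⁻ ij∈)) (proj₁ (∈-edges⁻ ji∈))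

edges-irrefl : {G : Graph n} {i : Fin n} → (i , i) ∉ edges G
edges-irrefl ii∈ = <-irrefl refl (proj₁ (∈-edges⁻ ii∈))

edges-zero∉ : {G : Graph (suc n)} {x : Fin (suc n)} → (x , zero) ∉ edges G
edges-zero∉ x0∈ with () ← proj₁ (∈-edges⁻ x0∈)

mapEdge : {n′ : ℕ} → (Fin n → Fin n′) → Edge n → Edge n′
mapEdge f (a , b) = f a , f b

mapEdge-injective : {n′ : ℕ} {f : Fin n → Fin n′} → (∀ {x y} → f x ≡ f y → x ≡ y) →
  ∀ {e e′} → mapEdge f e ≡ mapEdge f e′ → e ≡ e′
mapEdge-injective f-injective {_ , _} {_ , _} eq =
  cong₂ _,_ (f-injective (cong proj₁ eq)) (f-injective (cong proj₂ eq))

Joins : List (Edge n) → Fin n → Fin n → Set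
Joins S x y = (x , y) ∈ S ⊎ (y , x) ∈ S

Joins-sym : Symmetric (Joins S)
Joins-sym = Data.Sum.swap

Joins-⊆ : S₁ ⊆ S₂ → {x y : Fin n} → Joins S₁ x y → Joins S₂ x y
Joins-⊆ S₁⊆S₂ = Data.Sum.map S₁⊆S₂ S₁⊆S₂

Adj⇒Joins-edges : {G : Graph n} → Symmetric (Adj G) → {x y : Fin n} → Adj G x y → x ≢ y → Joins (edges G) x y
Adj⇒Joins-edges G-sym {x} {y} a x≢y with <-cmp (toℕ x) (toℕ y)
... | tri< x<y _ _ = inj₁ (∈-edges⁺ x<y a)
... | tri≈ _ x≡y _ = ⊥-elim (x≢y (toℕ-injective x≡y))
... | tri> _ _ y<x = inj₂ (∈-edges⁺ y<x (G-sym a))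

Joins-edges⇒∈ : {G : Graph n} {x y : Fin n} → S ⊆ edges G → (x , y) ∈ edges G → Joins S x y → (x , y) ∈ S
Joins-edges⇒∈ S⊆ xy∈ (inj₁ xy∈S) = xy∈S
Joins-edges⇒∈ S⊆ xy∈ (inj₂ yx∈S) = ⊥-elim (edges-swap∉ xy∈ (S⊆ yx∈S))

Joins-map⁺ : {n′ : ℕ} (f : Fin n → Fin n′) {x y : Fin n} → Joins S x y → Joins (map (mapEdge f) S) (f x) (f y)
Joins-map⁺ f = Data.Sum.map (∈-map⁺ (mapEdge f)) (∈-map⁺ (mapEdge f))

Joins-map⁻ : {n′ : ℕ} (f : Fin n → Fin n′) {a b : Fin n′} → Joins (map (mapEdge f) S) a b →
  ∃[ x ] ∃[ y ] Joins S x y × f x ≡ a × f y ≡ b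
Joins-map⁻ f (inj₁ ab∈) with (x , y) , xy∈ , refl ← ∈-map⁻ (mapEdge f) ab∈ = x , y , inj₁ xy∈ , refl , refl
Joins-map⁻ f (inj₂ ba∈) with (x , y) , xy∈ , refl ← ∈-map⁻ (mapEdge f) ba∈ = y , x , inj₂ xy∈ , refl , refl

Adj-graphOf⁻ : {x y : Fin n} → Adj (graphOf S) x y → Joins S x y
Adj-graphOf⁻ {S = S} {x} {y} a with (c , d) , cd∈ , t ← find (any⁻ _ S a)
                               with Equivalence.to (T-∨ {(c == x) ∧ (d == y)}) t
... | inj₁ t₁ = let c≡x , d≡y = Equivalence.to (T-∧ {c == x}) t₁ in
  inj₁ (subst₂ (λ c d → (c , d) ∈ S) (==⇒≡ c≡x) (==⇒≡ d≡y) cd∈)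
... | inj₂ t₂ = let c≡y , d≡x = Equivalence.to (T-∧ {c == y}) t₂ in
  inj₂ (subst₂ (λ c d → (c , d) ∈ S) (==⇒≡ c≡y) (==⇒≡ d≡x) cd∈)

Adj-graphOf⁺ : {x y : Fin n} → Joins S x y → Adj (graphOf S) x y
Adj-graphOf⁺ {S = (a , b) ∷ S} (inj₁ (here refl)) =
  T-∨ˡ (graphOf S a b) (T-∨ˡ ((a == b) ∧ (b == a)) (Equivalence.from T-∧ (≡⇒== {x = a} refl , ≡⇒== {x = b} refl)))
Adj-graphOf⁺ {S = (a , b) ∷ S} (inj₂ (here refl)) =
  T-∨ˡ (graphOf S b a) (T-∨ʳ ((a == b) ∧ (b == a)) (Equivalence.from T-∧ (≡⇒== {x = a} refl , ≡⇒== {x = b} refl)))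
Adj-graphOf⁺ {S = (a , b) ∷ S} {x} {y} (inj₁ (there xy∈)) =
  T-∨ʳ (((a == x) ∧ (b == y)) ∨ ((a == y) ∧ (b == x))) (Adj-graphOf⁺ (inj₁ xy∈))
Adj-graphOf⁺ {S = (a , b) ∷ S} {x} {y} (inj₂ (there yx∈)) =
  T-∨ʳ (((a == x) ∧ (b == y)) ∨ ((a == y) ∧ (b == x))) (Adj-graphOf⁺ (inj₂ yx∈))

Connected : List (Edge n) → Set
Connected S = ∀ x y → Star (Joins S) x y

Connected-map : {n′ : ℕ} {S′ : List (Edge n′)} (f : Fin n → Fin n′) (g : Fin n′ → Fin n) → (∀ y → f (g y) ≡ y) →
  (∀ {x y} → (x , y) ∈ S → Star (Joins S′) (f x) (f y)) → Connected S → Connected S′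
Connected-map {S = S} {S′ = S′} f g fg≡ walk connected a b =
  subst₂ (Star (Joins S′)) (fg≡ a) (fg≡ b) (kleisliStar f edge-walk (connected (g a) (g b)))
  where
  edge-walk : ∀ {x y} → Joins S x y → Star (Joins S′) (f x) (f y)
  edge-walk (inj₁ xy∈) = walk xy∈
  edge-walk (inj₂ yx∈) = reverse Joins-sym (walk yx∈)

-- Breadth-first search

module BreadthFirstSearch (Γ : Graph n) (r : Fin n) where

  reached : ℕ → Fin n → Bool
  reached k = iter k (step Γ) (_== r)

  reached-suc : ∀ k {y} → T (reached k y) → T (reached (suc k) y)
  reached-suc k {y} = T-∨ˡ (any (λ x → reached k x ∧ Γ x y) (allFin n))

  reached-step : ∀ k {x y} → T (reached k x) → Adj Γ x y → T (reached (suc k) y)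
  reached-step k {x} {y} t a =
    T-∨ʳ (reached k y) (any⁺ _ (lose (∈-allFin x) (Equivalence.from T-∧ (t , a))))

  reached-suc⁻ : ∀ k {y} → T (reached (suc k) y) → T (reached k y) ⊎ ∃[ x ] T (reached k x) × Adj Γ x y
  reached-suc⁻ k {y} t with Equivalence.to (T-∨ {reached k y}) t
  ... | inj₁ t′ = inj₁ t′
  ... | inj₂ t′ with x , _ , t″ ← find (any⁻ _ (allFin n) t′) = inj₂ (x , Equivalence.to T-∧ t″)

  reached-mono : ∀ {k k′ y} → k ≤ k′ → T (reached k y) → T (reached k′ y)
  reached-mono k≤k′ t with m≤n⇒m<n∨m≡n k≤k′
  ... | inj₂ refl = t
  reached-mono {k′ = suc k′} _ t | inj₁ (s≤s k≤k′) = reached-suc k′ (reached-mono k≤k′ t)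

  reached⇒Star : ∀ k {y} → T (reached k y) → Star (Adj Γ) r y
  reached⇒Star zero    t = subst (Star (Adj Γ) r) (sym (==⇒≡ t)) ε
  reached⇒Star (suc k) t with reached-suc⁻ k t
  ... | inj₁ t′           = reached⇒Star k t′
  ... | inj₂ (_ , t′ , a) = reached⇒Star k t′ ◅◅ (a ◅ ε)

  Star⇒reached : ∀ k {x y} → T (reached k x) → Star (Adj Γ) x y → ∃[ k′ ] T (reached k′ y)
  Star⇒reached k t ε       = k , t
  Star⇒reached k t (a ◅ w) = Star⇒reached (suc k) (reached-step k t a) w

  record Distance (y : Fin n) (ℓ : ℕ) : Set where
    field
      reached-at : T (reached ℓ y)
      not-before : ∀ {j} → j < ℓ → ¬ T (reached j y)
  open Distance

  distance : ∀ k {y} → T (reached k y) → ∃ (Distance y)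
  distance zero    t = zero , record { reached-at = t ; not-before = λ () }
  distance (suc k) {y} t with T? (reached k y)
  ... | yes t′ = distance k t′
  ... | no ¬t′ = suc k , record { reached-at = t ; not-before = λ { (s≤s j≤k) tj → ¬t′ (reached-mono j≤k tj) } }

  distance-unique : ∀ {y ℓ ℓ′} → Distance y ℓ → Distance y ℓ′ → ℓ ≡ ℓ′
  distance-unique {ℓ = ℓ} {ℓ′} d d′ with <-cmp ℓ ℓ′
  ... | tri< ℓ<ℓ′ _ _ = ⊥-elim (not-before d′ ℓ<ℓ′ (reached-at d))
  ... | tri≈ _ ℓ≡ℓ′ _ = ℓ≡ℓ′
  ... | tri> _ _ ℓ′<ℓ = ⊥-elim (not-before d ℓ′<ℓ (reached-at d′))

  distance-zero : ∀ {y} → Distance y 0 → y ≡ r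
  distance-zero d = ==⇒≡ (reached-at d)

  parent : ∀ {y ℓ} → Distance y (suc ℓ) → ∃[ p ] Distance p ℓ × Adj Γ p y
  parent {ℓ = ℓ} d with reached-suc⁻ ℓ (reached-at d)
  ... | inj₁ t = ⊥-elim (not-before d (n<1+n ℓ) t)
  ... | inj₂ (p , tp , a) =
    p , record { reached-at = tp ; not-before = λ {j} j<ℓ tj → not-before d (s≤s j<ℓ) (reached-step j tj a) } , a

  ancestor : ∀ {y ℓ} → Distance y ℓ → ∀ i → i ≤ ℓ → ∃[ z ] Distance z i
  ancestor {y} d i i≤ℓ with m≤n⇒m<n∨m≡n i≤ℓ
  ... | inj₂ refl = y , d
  ancestor {ℓ = suc ℓ} d i _ | inj₁ (s≤s i≤ℓ) = ancestor (proj₁ (proj₂ (parent d))) i i≤ℓ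

  -- The ancestors of y at distances 0, 1, …, ℓ are ℓ + 1 distinct vertices.
  distance<n : ∀ {y ℓ} → Distance y ℓ → ℓ < n
  distance<n {ℓ = ℓ} d = injective⇒≤ {f = proj₁ ∘ ancestorAt} ancestorAt-injective
    where
    ancestorAt : (i : Fin (suc ℓ)) → ∃[ z ] Distance z (toℕ i)
    ancestorAt i = ancestor d (toℕ i) (s≤s⁻¹ (toℕ<n i))
    ancestorAt-injective : ∀ {i j} → proj₁ (ancestorAt i) ≡ proj₁ (ancestorAt j) → i ≡ j
    ancestorAt-injective {i} {j} eq = toℕ-injective (distance-unique (proj₂ (ancestorAt i))
      (subst (λ z → Distance z (toℕ j)) (sym eq) (proj₂ (ancestorAt j))))

  Star⇒reachable : ∀ {y} → Star (Adj Γ) r y → T (reachable Γ r y)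
  Star⇒reachable w with k , t ← Star⇒reached 0 (≡⇒== {x = r} refl) w with _ , d ← distance k t =
    reached-mono (<⇒≤ (distance<n d)) (reached-at d)

connected⇒Star : (Γ : Graph n) → T (connected Γ) → ∀ x y → Star (Adj Γ) x y
connected⇒Star {n} Γ c x y = BreadthFirstSearch.reached⇒Star Γ x n
  (All.lookup (all⁺ _ (allFin n) (All.lookup (all⁺ _ (allFin n) c) (∈-allFin x))) (∈-allFin y))

Star⇒connected : (Γ : Graph n) → (∀ x y → Star (Adj Γ) x y) → T (connected Γ)
Star⇒connected {n} Γ w = all⁻ _ {xs = allFin n} (All.tabulate λ {x} _ →
  all⁻ _ {xs = allFin n} (All.tabulate λ {y} _ → BreadthFirstSearch.Star⇒reachable Γ x (w x y)))

connected-graphOf⁻ : T (connected (graphOf S)) → Connected S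
connected-graphOf⁻ {S = S} c x y = gmap id Adj-graphOf⁻ (connected⇒Star (graphOf S) c x y)

connected-graphOf⁺ : Connected S → T (connected (graphOf S))
connected-graphOf⁺ {S = S} c = Star⇒connected (graphOf S) λ x y → gmap id Adj-graphOf⁺ (c x y)

-- Spanning trees

-- Each non-root vertex owns the edge to its breadth-first parent.
Connected⇒length≥ : {S : List (Edge (suc m))} → Connected S → m ≤ length S
Connected⇒length≥ {m} {S} connected =
  subst (_≤ length S) (length-tabulate id)
    (matching⇒length≤ ParentEdge (Unique.allFin⁺ m) parentEdge parentEdge-injective)
  where
  open BreadthFirstSearch (graphOf S) zero

  record ParentEdge (i : Fin m) (e : Edge (suc m)) : Set where
    field
      level         : ℕ
      parentVertex  : Fin (suc m)
      parentAt      : Distance parentVertex level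
      childAt       : Distance (suc i) (suc level)
      orientation   : e ≡ (parentVertex , suc i) ⊎ e ≡ (suc i , parentVertex)
  open ParentEdge

  parentEdge : ∀ {i} → i ∈ allFin m → ∃[ e ] e ∈ S × ParentEdge i e
  parentEdge {i} _
    with k , t ← Star⇒reached 0 (≡⇒== {n = suc m} {x = zero} refl) (gmap id (Adj-graphOf⁺ {S = S}) (connected zero (suc i)))
    with distance k t
  ... | zero  , d with () ← distance-zero d
  ... | suc ℓ , d with p , dp , a ← parent d with Adj-graphOf⁻ a
  ... | inj₁ e∈ = _ , e∈ , record { level = ℓ ; parentVertex = p ; parentAt = dp ; childAt = d ; orientation = inj₁ refl }
  ... | inj₂ e∈ = _ , e∈ , record { level = ℓ ; parentVertex = p ; parentAt = dp ; childAt = d ; orientation = inj₂ refl }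

  crossed : ∀ {i i′ e e′} (P : ParentEdge i e) (P′ : ParentEdge i′ e′) →
    parentVertex P ≡ suc i′ → suc i ≡ parentVertex P′ → ⊥
  crossed P P′ p≡ p′≡ = <-irrefl (trans ℓ≡1+ℓ′ (cong suc ℓ′≡1+ℓ)) (m<n⇒m<1+n (n<1+n (level P)))
    where
    ℓ≡1+ℓ′ = distance-unique (subst (λ z → Distance z (level P)) p≡ (parentAt P)) (childAt P′)
    ℓ′≡1+ℓ = distance-unique (subst (λ z → Distance z (level P′)) (sym p′≡) (parentAt P′)) (childAt P)

  parentEdge-injective : ∀ {i i′ e} → i ∈ allFin m → i′ ∈ allFin m → ParentEdge i e → ParentEdge i′ e → i ≡ i′
  parentEdge-injective _ _ P P′ with orientation P | orientation P′
  ... | inj₁ o | inj₁ o′ = Fin-suc-injective (cong proj₂ (trans (sym o) o′))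
  ... | inj₂ o | inj₂ o′ = Fin-suc-injective (cong proj₁ (trans (sym o) o′))
  ... | inj₁ o | inj₂ o′ = ⊥-elim (crossed P P′ (cong proj₁ (trans (sym o) o′)) (cong proj₂ (trans (sym o) o′)))
  ... | inj₂ o | inj₁ o′ = ⊥-elim (crossed P′ P (cong proj₁ (trans (sym o′) o)) (cong proj₂ (trans (sym o′) o)))

spanningTrees : Graph n → List (List (Edge n))
spanningTrees {n} G = filterᵇ (isSpanningTree n) (subsets (edges G))

record SpanningTree {m : ℕ} (G : Graph (suc m)) (S : List (Edge (suc m))) : Set where
  field
    ∈subsets    : S ∈ subsets (edges G)
    isConnected : Connected S
    size        : length S ≡ m

  ⊆edges : S ⊆ edges G
  ⊆edges = ∈-subsets⇒⊆ ∈subsets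

spanningTree-≡ : {G : Graph (suc m)} → SpanningTree G S₁ → SpanningTree G S₂ → S₁ ⊆ S₂ → S₂ ⊆ S₁ → S₁ ≡ S₂
spanningTree-≡ {G = G} t₁ t₂ = ∈-subsets-≡ (edges-unique G) (SpanningTree.∈subsets t₁) (SpanningTree.∈subsets t₂)

∈-spanningTrees⁻ : {G : Graph (suc m)} → S ∈ spanningTrees G → SpanningTree G S
∈-spanningTrees⁻ {m} S∈ =
  let S∈subsets , ok = ∈-filterᵇ⁻ (isSpanningTree (suc m)) S∈
      c , l = Equivalence.to T-∧ ok
  in record { ∈subsets = S∈subsets ; isConnected = connected-graphOf⁻ c ; size = ≡ᵇ⇒≡ _ _ l }

∈-spanningTrees⁺ : {G : Graph (suc m)} → SpanningTree G S → S ∈ spanningTrees G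
∈-spanningTrees⁺ {m} t = ∈-filterᵇ⁺ (isSpanningTree (suc m)) ∈subsets
  (Equivalence.from T-∧ (connected-graphOf⁺ isConnected , ≡⇒≡ᵇ _ m size))
  where open SpanningTree t

spanningTrees-unique : (G : Graph n) → Unique (spanningTrees G)
spanningTrees-unique G = Unique.filter⁺ _ (subsets-unique (edges-unique G))

_≟ₑ_ : (e f : Edge n) → Dec (e ≡ f)
_≟ₑ_ = ≡-dec _≟_ _≟_

_∈ₑ?_ : (e : Edge n) (S : List (Edge n)) → Dec (e ∈ S)
e ∈ₑ? S = Any.any? (e ≟ₑ_) S

_∖_ : List (Edge n) → Edge n → List (Edge n)
S ∖ e = filter (λ f → ¬? (f ≟ₑ e)) S

∈-∖⁺ : {e f : Edge n} → f ∈ S → f ≢ e → f ∈ S ∖ e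
∈-∖⁺ = ∈-filter⁺ _

∈-∖⁻ : {e f : Edge n} → f ∈ S ∖ e → f ∈ S × f ≢ e
∈-∖⁻ = ∈-filter⁻ _

∖-⊆ : {e : Edge n} → S ∖ e ⊆ S
∖-⊆ = proj₁ ∘ ∈-∖⁻

∖-length< : {e : Edge n} → e ∈ S → length (S ∖ e) < length S
∖-length< {S = S} e∈ = filter-notAll _ S (Any.map (λ e≡f f≢e → f≢e (sym e≡f)) e∈)

spanningTree-bridge : {G : Graph (suc m)} → SpanningTree G S → {x y : Fin (suc m)} → (x , y) ∈ S →
  ¬ Star (Joins (S ∖ (x , y))) x y
spanningTree-bridge {S = S} t {x} {y} xy∈ walk =
  <⇒≱ (subst (length (S ∖ (x , y)) <_) size (∖-length< xy∈)) (Connected⇒length≥ connected′)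
  where
  open SpanningTree t
  reroute : ∀ {a b} → (a , b) ∈ S → Star (Joins (S ∖ (x , y))) a b
  reroute {a} {b} ab∈ with (a , b) ≟ₑ (x , y)
  ... | yes refl = walk
  ... | no ab≢xy = inj₁ (∈-∖⁺ ab∈ ab≢xy) ◅ ε
  connected′ : Connected (S ∖ (x , y))
  connected′ = Connected-map id id (λ _ → refl) reroute isConnected

spanningTree-triangle : {G : Graph (suc m)} → SpanningTree G S → {x y z : Fin (suc m)} →
  (z , x) ∈ S → (z , y) ∈ S → (x , y) ∈ S → z ≢ x → ⊥
spanningTree-triangle t zx∈ zy∈ xy∈ z≢x = spanningTree-bridge t xy∈
  (inj₂ (∈-∖⁺ zx∈ (z≢x ∘ cong proj₁)) ◅ inj₁ (∈-∖⁺ zy∈ (z≢x ∘ cong proj₁)) ◅ ε)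

-- Trees are built as arbitrary edge lists L and then put into the sublist form counted by numSpanningTrees.
restrict : Graph n → List (Edge n) → List (Edge n)
restrict G L = filterᵇ (uncurry (graphOf L)) (edges G)

module _ {G : Graph n} {L : List (Edge n)} where

  ∈-restrict⁻ : {a b : Fin n} → (a , b) ∈ restrict G L → (a , b) ∈ edges G × Joins L a b
  ∈-restrict⁻ ab∈ = Data.Product.map₂ Adj-graphOf⁻ (∈-filterᵇ⁻ _ ab∈)

  ∈-restrict⁺ : {a b : Fin n} → (a , b) ∈ edges G → Joins L a b → (a , b) ∈ restrict G L
  ∈-restrict⁺ ab∈ j = ∈-filterᵇ⁺ _ ab∈ (Adj-graphOf⁺ j)

  Joins-restrict : {a b : Fin n} → Joins (edges G) a b → Joins L a b → Joins (restrict G L) a b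
  Joins-restrict (inj₁ ab∈) j = inj₁ (∈-restrict⁺ ab∈ j)
  Joins-restrict (inj₂ ba∈) j = inj₂ (∈-restrict⁺ ba∈ (Joins-sym j))

  restrict-length≤ : length (restrict G L) ≤ length L
  restrict-length≤ =
    matching⇒length≤ (λ e e′ → e′ ≡ e ⊎ e′ ≡ swap e) (Unique.filter⁺ _ (edges-unique G)) partner same-edge
    where
    partner : ∀ {e} → e ∈ restrict G L → ∃[ e′ ] e′ ∈ L × (e′ ≡ e ⊎ e′ ≡ swap e)
    partner {a , b} e∈ with proj₂ (∈-restrict⁻ e∈)
    ... | inj₁ ab∈ = _ , ab∈ , inj₁ refl
    ... | inj₂ ba∈ = _ , ba∈ , inj₂ refl
    edge : ∀ {e} → e ∈ restrict G L → e ∈ edges G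
    edge {a , b} e∈ = proj₁ (∈-restrict⁻ e∈)
    same-edge : ∀ {e₁ e₂ e′} → e₁ ∈ restrict G L → e₂ ∈ restrict G L →
      e′ ≡ e₁ ⊎ e′ ≡ swap e₁ → e′ ≡ e₂ ⊎ e′ ≡ swap e₂ → e₁ ≡ e₂
    same-edge _   _   (inj₁ refl) (inj₁ eq) = eq
    same-edge _   _   (inj₂ refl) (inj₂ eq) = cong swap eq
    same-edge e₁∈ e₂∈ (inj₁ refl) (inj₂ refl) = ⊥-elim (edges-swap∉ (edge e₂∈) (edge e₁∈))
    same-edge e₁∈ e₂∈ (inj₂ refl) (inj₁ refl) = ⊥-elim (edges-swap∉ (edge e₁∈) (edge e₂∈))

restrict-≡⇒Joins : {G : Graph n} {L₁ L₂ : List (Edge n)} → restrict G L₁ ≡ restrict G L₂ →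
  {a b : Fin n} → Joins (edges G) a b → Joins L₁ a b → Joins L₂ a b
restrict-≡⇒Joins {G = G} {L₁} {L₂} eq j j₁ with subst (λ R → Joins R _ _) eq (Joins-restrict {L = L₁} j j₁)
... | inj₁ ab∈ = proj₂ (∈-restrict⁻ {G = G} ab∈)
... | inj₂ ba∈ = Joins-sym (proj₂ (∈-restrict⁻ {G = G} ba∈))

restrict-spanningTree : {G : Graph (suc m)} {L : List (Edge (suc m))} →
  (∀ {x y} → (x , y) ∈ L → Joins (edges G) x y) → Connected L → length L ≤ m → SpanningTree G (restrict G L)
restrict-spanningTree {G = G} {L} L-edges L-connected L-length = record
  { ∈subsets    = filter-∈-subsets _ (edges G)
  ; isConnected = connected′
  ; size        = ≤-antisym (≤-trans (restrict-length≤ {G = G} {L = L}) L-length) (Connected⇒length≥ connected′)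
  }
  where
  connected′ : Connected (restrict G L)
  connected′ = Connected-map id id (λ _ → refl) (λ xy∈ → Joins-restrict (L-edges xy∈) (inj₁ xy∈) ◅ ε) L-connected

-- A spanning tree is a sublist of the duplicate-free list edges G, so recovering S₁ ⊆ S₂ shows injectivity.
numSpanningTrees≤ : {G : Graph (suc m)} {ys : List B} (f : List (Edge (suc m)) → B) →
  (∀ {S} → SpanningTree G S → f S ∈ ys) →
  (∀ {S₁ S₂} → SpanningTree G S₁ → SpanningTree G S₂ → f S₁ ≡ f S₂ → S₁ ⊆ S₂) →
  numSpanningTrees G ≤ length ys
numSpanningTrees≤ {G = G} f f∈ f-injective = injection⇒length≤ f (spanningTrees-unique G)
  (f∈ ∘ ∈-spanningTrees⁻)
  λ S₁∈ S₂∈ eq → let t₁ = ∈-spanningTrees⁻ S₁∈; t₂ = ∈-spanningTrees⁻ S₂∈ in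
    spanningTree-≡ t₁ t₂ (f-injective t₁ t₂ eq) (f-injective t₂ t₁ (sym eq))

-- Relabelling and adding a vertex

module _ {G H : Graph (suc m)} (G-sym : Symmetric (Adj G)) (σ : Fin (suc m) ↔ Fin (suc m))
         (H≡G∘σ : ∀ x y → H x y ≡ G (Inverse.to σ x) (Inverse.to σ y)) where

  private
    π = Inverse.to σ
    ρ = Inverse.from σ

    π-injective : ∀ {x y} → π x ≡ π y → x ≡ y
    π-injective {x} {y} eq =
      trans (sym (Inverse.strictlyInverseʳ σ x)) (trans (cong ρ eq) (Inverse.strictlyInverseʳ σ y))

    relabelTree : List (Edge (suc m)) → List (Edge (suc m))
    relabelTree S = restrict G (map (mapEdge π) S)

    edge-image : ∀ {x y} → (x , y) ∈ edges H → Joins (edges G) (π x) (π y)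
    edge-image xy∈ = let x<y , a = ∈-edges⁻ xy∈ in
      Adj⇒Joins-edges G-sym (subst T (H≡G∘σ _ _) a) (λ eq → <-irrefl (cong toℕ (π-injective eq)) x<y)

    relabelTree-spanning : ∀ {S} → SpanningTree H S → SpanningTree G (relabelTree S)
    relabelTree-spanning {S} t = restrict-spanningTree image-edges
      (Connected-map π ρ (Inverse.strictlyInverseˡ σ) (λ xy∈ → Joins-map⁺ π (inj₁ xy∈) ◅ ε) isConnected)
      (≤-reflexive (trans (length-map _ S) size))
      where
      open SpanningTree t
      image-edges : ∀ {a b} → (a , b) ∈ map (mapEdge π) S → Joins (edges G) a b
      image-edges ab∈ with (x , y) , xy∈ , refl ← ∈-map⁻ _ ab∈ = edge-image (⊆edges xy∈)

    relabelTree-injective : ∀ {S₁ S₂} → SpanningTree H S₁ → SpanningTree H S₂ →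
      relabelTree S₁ ≡ relabelTree S₂ → S₁ ⊆ S₂
    relabelTree-injective {S₂ = S₂} t₁ t₂ eq {x , y} xy∈ = recover (SpanningTree.⊆edges t₁ xy∈)
      where
      recover : (x , y) ∈ edges H → (x , y) ∈ S₂
      recover xy∈H
        with x′ , y′ , j , πx′≡πx , πy′≡πy ←
               Joins-map⁻ π (restrict-≡⇒Joins eq (edge-image xy∈H) (Joins-map⁺ π (inj₁ xy∈)))
        rewrite π-injective πx′≡πx | π-injective πy′≡πy = Joins-edges⇒∈ (SpanningTree.⊆edges t₂) xy∈H j

  numSpanningTrees-relabel≤ : numSpanningTrees H ≤ numSpanningTrees G
  numSpanningTrees-relabel≤ =
    numSpanningTrees≤ relabelTree (∈-spanningTrees⁺ ∘ relabelTree-spanning) relabelTree-injective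

numSpanningTrees-relabel : {G H : Graph (suc m)} → Symmetric (Adj G) → (σ : Fin (suc m) ↔ Fin (suc m)) →
  (∀ x y → H x y ≡ G (Inverse.to σ x) (Inverse.to σ y)) → numSpanningTrees H ≡ numSpanningTrees G
numSpanningTrees-relabel {G = G} {H} G-sym σ H≡G∘σ =
  ≤-antisym (numSpanningTrees-relabel≤ G-sym σ H≡G∘σ) (numSpanningTrees-relabel≤ H-sym (↔-sym σ) G≡H∘σ⁻¹)
  where
  H-sym : Symmetric (Adj H)
  H-sym {x} {y} a = subst T (sym (H≡G∘σ y x)) (G-sym (subst T (H≡G∘σ x y) a))
  G≡H∘σ⁻¹ : ∀ x y → G x y ≡ H (Inverse.from σ x) (Inverse.from σ y)
  G≡H∘σ⁻¹ x y = trans (sym (cong₂ G (Inverse.strictlyInverseˡ σ x) (Inverse.strictlyInverseˡ σ y)))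
    (sym (H≡G∘σ (Inverse.from σ x) (Inverse.from σ y)))

module AddVertexEdges (G : Graph (suc m)) (u v : Fin (suc m)) where

  ∈-edges-addVertex-zero⁻ : ∀ {y} → (zero , y) ∈ edges (addVertex G u v) → y ≡ suc u ⊎ y ≡ suc v
  ∈-edges-addVertex-zero⁻ {zero}  0y∈ = ⊥-elim (edges-irrefl {G = addVertex G u v} 0y∈)
  ∈-edges-addVertex-zero⁻ {suc j} 0y∈ =
    Data.Sum.map (cong suc ∘ ==⇒≡) (cong suc ∘ ==⇒≡)
      (Equivalence.to T-∨ (proj₂ (∈-edges⁻ {G = addVertex G u v} 0y∈)))

  ∈-edges-addVertex-zero⁺ : ∀ {x} → x ≡ u ⊎ x ≡ v → (zero , suc x) ∈ edges (addVertex G u v)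
  ∈-edges-addVertex-zero⁺ {x} x≡ = ∈-edges⁺ {G = addVertex G u v} (s≤s z≤n)
    (Equivalence.from T-∨ (Data.Sum.map (≡⇒== {x = x}) (≡⇒== {x = x}) x≡))

  ∈-edges-addVertex-suc⁻ : ∀ {a b} → (suc a , suc b) ∈ edges (addVertex G u v) → (a , b) ∈ edges G
  ∈-edges-addVertex-suc⁻ ab∈ = let a<b , adj = ∈-edges⁻ {G = addVertex G u v} ab∈ in ∈-edges⁺ (s≤s⁻¹ a<b) adj

  ∈-edges-addVertex-suc⁺ : ∀ {a b} → (a , b) ∈ edges G → (suc a , suc b) ∈ edges (addVertex G u v)
  ∈-edges-addVertex-suc⁺ ab∈ = let a<b , adj = ∈-edges⁻ ab∈ in ∈-edges⁺ {G = addVertex G u v} (s≤s a<b) adj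

module _ {G : Graph (suc m)} {u v : Fin (suc m)} where

  open AddVertexEdges G u v

  private
    G′ = addVertex G u v

    attachedEdges : Fin (suc m) → List (Edge (suc m)) → List (Edge (suc (suc m)))
    attachedEdges c S = (zero , suc c) ∷ map (mapEdge suc) S

    attach : Fin (suc m) → List (Edge (suc m)) → List (Edge (suc (suc m)))
    attach c S = restrict G′ (attachedEdges c S)

    Joins-attachedEdges⁺ : ∀ {c S a b} → Joins S a b → Joins (attachedEdges c S) (suc a) (suc b)
    Joins-attachedEdges⁺ = Joins-⊆ there ∘ Joins-map⁺ suc

    Joins-attachedEdges⁻ : ∀ {c S a b} → Joins (attachedEdges c S) (suc a) (suc b) → Joins S a b
    Joins-attachedEdges⁻ (inj₁ (there ab∈)) = inj₁ (∈-map-injective⁻ (mapEdge-injective Fin-suc-injective) ab∈)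
    Joins-attachedEdges⁻ (inj₂ (there ba∈)) = inj₂ (∈-map-injective⁻ (mapEdge-injective Fin-suc-injective) ba∈)

    attach-spanning : ∀ {c S} → c ≡ u ⊎ c ≡ v → SpanningTree G S → SpanningTree G′ (attach c S)
    attach-spanning {c} {S} c≡ t = restrict-spanningTree L-edges L-connected
      (≤-reflexive (cong suc (trans (length-map _ S) size)))
      where
      open SpanningTree t
      L-edges : ∀ {x y} → (x , y) ∈ attachedEdges c S → Joins (edges G′) x y
      L-edges (here refl) = inj₁ (∈-edges-addVertex-zero⁺ c≡)
      L-edges (there xy∈) with (a , b) , ab∈ , refl ← ∈-map⁻ _ xy∈ = inj₁ (∈-edges-addVertex-suc⁺ (⊆edges ab∈))
      lift : ∀ {a b} → Star (Joins S) a b → Star (Joins (attachedEdges c S)) (suc a) (suc b)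
      lift = gmap suc Joins-attachedEdges⁺
      L-connected : Connected (attachedEdges c S)
      L-connected zero    zero    = ε
      L-connected zero    (suc b) = inj₁ (here refl) ◅ lift (isConnected c b)
      L-connected (suc a) zero    = lift (isConnected a c) ◅◅ (inj₂ (here refl) ◅ ε)
      L-connected (suc a) (suc b) = lift (isConnected a b)

    attach-injective : ∀ {c₁ c₂ S₁ S₂} → c₁ ≡ u ⊎ c₁ ≡ v → SpanningTree G S₁ → SpanningTree G S₂ →
      attach c₁ S₁ ≡ attach c₂ S₂ → c₁ ≡ c₂ × S₁ ⊆ S₂
    attach-injective {c₁} {c₂} {S₁} {S₂} c₁≡ t₁ t₂ eq = same-hook hooked , same-tree
      where
      joined : ∀ {a b} → Joins (edges G′) a b → Joins (attachedEdges c₁ S₁) a b → Joins (attachedEdges c₂ S₂) a b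
      joined = restrict-≡⇒Joins {G = G′} {attachedEdges c₁ S₁} {attachedEdges c₂ S₂} eq
      hooked : Joins (attachedEdges c₂ S₂) zero (suc c₁)
      hooked = joined (inj₁ (∈-edges-addVertex-zero⁺ c₁≡)) (inj₁ (here refl))
      same-hook : Joins (attachedEdges c₂ S₂) zero (suc c₁) → c₁ ≡ c₂
      same-hook (inj₁ (here eq)) = Fin-suc-injective (cong proj₂ eq)
      same-hook (inj₁ (there 0c∈)) with _ , _ , () ← ∈-map⁻ _ 0c∈
      same-hook (inj₂ (there c0∈)) with _ , _ , () ← ∈-map⁻ _ c0∈
      same-tree : S₁ ⊆ S₂
      same-tree {a , b} ab∈ = Joins-edges⇒∈ (SpanningTree.⊆edges t₂) ab∈G
        (Joins-attachedEdges⁻ (joined (inj₁ (∈-edges-addVertex-suc⁺ ab∈G)) (Joins-attachedEdges⁺ (inj₁ ab∈))))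
        where ab∈G = SpanningTree.⊆edges t₁ ab∈

  numSpanningTrees-addVertex≥ : u ≢ v → 2 * numSpanningTrees G ≤ numSpanningTrees G′
  numSpanningTrees-addVertex≥ u≢v =
    subst (_≤ numSpanningTrees G′) (length-cartesianProduct (u ∷ v ∷ []) (spanningTrees G))
      (injection⇒length≤ (uncurry attach)
        (Unique.cartesianProduct⁺ ((u≢v All.∷ All.[]) ∷ All.[] ∷ []) (spanningTrees-unique G))
        attach∈ attach-injective′)
    where
    hook : ∀ {c} → c ∈ u ∷ v ∷ [] → c ≡ u ⊎ c ≡ v
    hook (here c≡u)         = inj₁ c≡u
    hook (there (here c≡v)) = inj₂ c≡v
    attach∈ : ∀ {cS} → cS ∈ cartesianProduct (u ∷ v ∷ []) (spanningTrees G) → uncurry attach cS ∈ spanningTrees G′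
    attach∈ {c , S} cS∈ = let c∈ , S∈ = ∈-cartesianProduct⁻ _ _ cS∈ in
      ∈-spanningTrees⁺ (attach-spanning (hook c∈) (∈-spanningTrees⁻ S∈))
    attach-injective′ : ∀ {cS cS′} → cS ∈ cartesianProduct (u ∷ v ∷ []) (spanningTrees G) →
      cS′ ∈ cartesianProduct (u ∷ v ∷ []) (spanningTrees G) → uncurry attach cS ≡ uncurry attach cS′ → cS ≡ cS′
    attach-injective′ {c₁ , S₁} {c₂ , S₂} cS₁∈ cS₂∈ eq =
      let c₁∈ , S₁∈ = ∈-cartesianProduct⁻ _ _ cS₁∈
          c₂∈ , S₂∈ = ∈-cartesianProduct⁻ _ _ cS₂∈
          t₁ = ∈-spanningTrees⁻ S₁∈
          t₂ = ∈-spanningTrees⁻ S₂∈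
          c₁≡c₂ , S₁⊆S₂ = attach-injective (hook c₁∈) t₁ t₂ eq
      in cong₂ _,_ c₁≡c₂ (spanningTree-≡ t₁ t₂ S₁⊆S₂ (proj₂ (attach-injective (hook c₂∈) t₂ t₁ (sym eq))))

module _ {G : Graph (suc m)} (G-sym : Symmetric (Adj G)) {u v : Fin (suc m)} (uv : Adj G u v) where

  open AddVertexEdges G u v

  private
    G′ = addVertex G u v

    zeroPattern : List (Edge (suc (suc m))) → Bool × Bool
    zeroPattern S = does ((zero , suc u) ∈ₑ? S) , does ((zero , suc v) ∈ₑ? S)

    patterns : List (Bool × Bool)
    patterns = (true , false) ∷ (false , true) ∷ (true , true) ∷ []

    does-pair∈patterns : ∀ {P Q : Set} (p? : Dec P) (q? : Dec Q) → P ⊎ Q → (does p? , does q?) ∈ patterns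
    does-pair∈patterns (yes _) (no _)  _        = here refl
    does-pair∈patterns (no _)  (yes _) _        = there (here refl)
    does-pair∈patterns (yes _) (yes _) _        = there (there (here refl))
    does-pair∈patterns (no ¬p) (no _)  (inj₁ p) = ⊥-elim (¬p p)
    does-pair∈patterns (no _)  (no ¬q) (inj₂ q) = ⊥-elim (¬q q)

    hub : List (Edge (suc (suc m))) → Fin (suc m)
    hub S = if proj₁ (zeroPattern S) then u else v

    hub-uv : ∀ S → hub S ≡ u ⊎ hub S ≡ v
    hub-uv S with proj₁ (zeroPattern S)
    ... | true  = inj₁ refl
    ... | false = inj₂ refl

    zero-edge : ∀ {S} → SpanningTree G′ S → (zero , suc u) ∈ S ⊎ (zero , suc v) ∈ S
    zero-edge t with SpanningTree.isConnected t zero (suc u)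
    ... | inj₁ 0x∈ ◅ _ with ∈-edges-addVertex-zero⁻ (SpanningTree.⊆edges t 0x∈)
    ...   | inj₁ refl = inj₁ 0x∈
    ...   | inj₂ refl = inj₂ 0x∈
    zero-edge t | inj₂ x0∈ ◅ _ = ⊥-elim (edges-zero∉ {G = G′} (SpanningTree.⊆edges t x0∈))

    hub-edge : ∀ {S} → SpanningTree G′ S → (zero , suc (hub S)) ∈ S
    hub-edge {S} t = choose ((zero , suc u) ∈ₑ? S) (zero-edge t)
      where
      choose : (d : Dec ((zero , suc u) ∈ S)) → (zero , suc u) ∈ S ⊎ (zero , suc v) ∈ S →
        (zero , suc (if does d then u else v)) ∈ S
      choose (yes 0u∈) _          = 0u∈
      choose (no 0u∉)  (inj₁ 0u∈) = ⊥-elim (0u∉ 0u∈)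
      choose (no _)    (inj₂ 0v∈) = 0v∈

    Adj-uv : ∀ {x y} → x ≡ u ⊎ x ≡ v → y ≡ u ⊎ y ≡ v → x ≢ y → Adj G x y
    Adj-uv (inj₁ refl) (inj₁ refl) x≢y = ⊥-elim (x≢y refl)
    Adj-uv (inj₁ refl) (inj₂ refl) _   = uv
    Adj-uv (inj₂ refl) (inj₁ refl) _   = G-sym uv
    Adj-uv (inj₂ refl) (inj₂ refl) x≢y = ⊥-elim (x≢y refl)

    collapse : Fin (suc m) → Fin (suc (suc m)) → Fin (suc m)
    collapse c zero    = c
    collapse c (suc a) = a

    contractedEdges : List (Edge (suc (suc m))) → List (Edge (suc m))
    contractedEdges S = map (mapEdge (collapse (hub S))) (S ∖ (zero , suc (hub S)))

    contract : List (Edge (suc (suc m))) → List (Edge (suc m))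
    contract S = restrict G (contractedEdges S)

    contract-spanning : ∀ {S} → SpanningTree G′ S → SpanningTree G (contract S)
    contract-spanning {S} t = restrict-spanningTree L-edges L-connected L-length
      where
      open SpanningTree t
      c = hub S
      edge-image : ∀ {x y} → (x , y) ∈ S → (x , y) ≢ (zero , suc c) → Joins (edges G) (collapse c x) (collapse c y)
      edge-image {zero}  {zero}  xy∈ _  = ⊥-elim (edges-irrefl {G = G′} (⊆edges xy∈))
      edge-image {zero}  {suc j} xy∈ xy≢ = Adj⇒Joins-edges G-sym (Adj-uv (hub-uv S) j-uv c≢j) c≢j
        where
        j-uv : j ≡ u ⊎ j ≡ v
        j-uv = Data.Sum.map Fin-suc-injective Fin-suc-injective (∈-edges-addVertex-zero⁻ (⊆edges xy∈))
        c≢j : c ≢ j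
        c≢j refl = xy≢ refl
      edge-image {suc a} {zero}  xy∈ _  = ⊥-elim (edges-zero∉ {G = G′} (⊆edges xy∈))
      edge-image {suc a} {suc b} xy∈ _  = inj₁ (∈-edges-addVertex-suc⁻ (⊆edges xy∈))
      L-edges : ∀ {a b} → (a , b) ∈ contractedEdges S → Joins (edges G) a b
      L-edges ab∈ with (x , y) , xy∈∖ , refl ← ∈-map⁻ _ ab∈ = let xy∈ , xy≢ = ∈-∖⁻ xy∈∖ in edge-image xy∈ xy≢
      reroute : ∀ {x y} → (x , y) ∈ S → Star (Joins (contractedEdges S)) (collapse c x) (collapse c y)
      reroute {x} {y} xy∈ with (x , y) ≟ₑ (zero , suc c)
      ... | yes refl = ε
      ... | no xy≢   = inj₁ (∈-map⁺ _ (∈-∖⁺ xy∈ xy≢)) ◅ ε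
      L-connected : Connected (contractedEdges S)
      L-connected = Connected-map (collapse c) suc (λ _ → refl) reroute isConnected
      L-length : length (contractedEdges S) ≤ m
      L-length = s≤s⁻¹ (subst₂ _<_ (sym (length-map _ (S ∖ (zero , suc c)))) size (∖-length< (hub-edge t)))

    contract-injective : ∀ {S₁ S₂} → SpanningTree G′ S₁ → SpanningTree G′ S₂ →
      (zeroPattern S₁ , contract S₁) ≡ (zeroPattern S₂ , contract S₂) → S₁ ⊆ S₂
    contract-injective {S₁} {S₂} t₁ t₂ eq = same-edges
      where
      open SpanningTree using (⊆edges)
      pattern≡ : zeroPattern S₁ ≡ zeroPattern S₂
      pattern≡ = cong proj₁ eq

      same-zero-edges : ∀ {S S′} → zeroPattern S ≡ zeroPattern S′ → SpanningTree G′ S →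
        ∀ {y} → (zero , y) ∈ S → (zero , y) ∈ S′
      same-zero-edges {S} {S′} p≡ t 0y∈ with ∈-edges-addVertex-zero⁻ (⊆edges t 0y∈)
      ... | inj₁ refl = T-does⁻ (_ ∈ₑ? S′) (subst T (cong proj₁ p≡) (T-does⁺ (_ ∈ₑ? S) 0y∈))
      ... | inj₂ refl = T-does⁻ (_ ∈ₑ? S′) (subst T (cong proj₂ p≡) (T-does⁺ (_ ∈ₑ? S) 0y∈))

      hub₂-edge : ∀ {x} → hub S₂ ≡ x → (zero , suc x) ∈ S₁
      hub₂-edge hub≡x = subst (λ c → (zero , suc c) ∈ S₁)
        (trans (cong (λ p → if proj₁ p then u else v) pattern≡) hub≡x) (hub-edge t₁)

      zero-edge₂ : ∀ {x} → Joins (S₂ ∖ (zero , suc (hub S₂))) zero (suc x) → (zero , suc x) ∈ S₁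
      zero-edge₂ (inj₁ 0x∈) = same-zero-edges (sym pattern≡) t₂ (∖-⊆ 0x∈)
      zero-edge₂ (inj₂ x0∈) = ⊥-elim (edges-zero∉ {G = G′} (⊆edges t₂ (∖-⊆ x0∈)))

      -- Other than as itself, the edge ab can only come from S₂ through the hub, which closes a triangle in S₁.
      lifted : ∀ {a b} → (suc a , suc b) ∈ S₁ → (suc a , suc b) ∈ S₂
      lifted {a} {b} ab∈ with Joins-map⁻ (collapse (hub S₂))
        (restrict-≡⇒Joins {G = G} {contractedEdges S₁} {contractedEdges S₂} (cong proj₂ eq)
          (inj₁ (∈-edges-addVertex-suc⁻ (⊆edges t₁ ab∈))) (inj₁ (∈-map⁺ _ (∈-∖⁺ ab∈ λ ()))))
      ... | suc _ , suc _ , j , refl , refl = Joins-edges⇒∈ {G = G′} (⊆edges t₂) (⊆edges t₁ ab∈) (Joins-⊆ ∖-⊆ j)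
      ... | zero  , zero  , j , _ , _ = ⊥-elim (edges-irrefl {G = G′} (⊆edges t₂ (∖-⊆ (Data.Sum.reduce j))))
      ... | zero  , suc _ , j , hub≡a , refl =
        ⊥-elim (spanningTree-triangle t₁ (hub₂-edge hub≡a) (zero-edge₂ j) ab∈ λ ())
      ... | suc _ , zero  , j , refl , hub≡b =
        ⊥-elim (spanningTree-triangle t₁ (zero-edge₂ (Joins-sym j)) (hub₂-edge hub≡b) ab∈ λ ())

      same-edges : S₁ ⊆ S₂
      same-edges {zero  , y}     xy∈ = same-zero-edges pattern≡ t₁ xy∈
      same-edges {suc a , zero}  xy∈ = ⊥-elim (edges-zero∉ {G = G′} (⊆edges t₁ xy∈))
      same-edges {suc a , suc b} xy∈ = lifted xy∈

  numSpanningTrees-addVertex≤ : numSpanningTrees G′ ≤ 3 * numSpanningTrees G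
  numSpanningTrees-addVertex≤ =
    subst (numSpanningTrees G′ ≤_) (length-cartesianProduct patterns (spanningTrees G))
      (numSpanningTrees≤ (λ S → zeroPattern S , contract S)
        (λ {S} t → ∈-cartesianProduct⁺ (does-pair∈patterns (_ ∈ₑ? S) (_ ∈ₑ? S) (zero-edge t))
                                       (∈-spanningTrees⁺ {G = G} (contract-spanning t)))
        contract-injective)

-- 2-trees

twoTree-order : {G : Graph n} → TwoTree n G → 2 ≤ n
twoTree-order base               = s≤s (s≤s z≤n)
twoTree-order (extend t _ _ _)   = m≤n⇒m≤1+n (twoTree-order t)
twoTree-order (relabel t _ _ _)  = twoTree-order t

twoTree-symmetric : {G : Graph n} → TwoTree n G → Symmetric (Adj G)
twoTree-symmetric base {zero}     {zero}     ()
twoTree-symmetric base {zero}     {suc zero} _ = tt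
twoTree-symmetric base {suc zero} {zero}     _ = tt
twoTree-symmetric base {suc zero} {suc zero} ()
twoTree-symmetric (extend t _ _ _) {zero}  {suc _} a = a
twoTree-symmetric (extend t _ _ _) {suc _} {zero}  a = a
twoTree-symmetric (extend t _ _ _) {suc _} {suc _} a = twoTree-symmetric t a
twoTree-symmetric (relabel t _ _ H≡) {x} {y} a =
  subst T (sym (H≡ y x)) (twoTree-symmetric t (subst T (H≡ x y) a))

twoTree-loopless : {G : Graph n} → TwoTree n G → Loopless G
twoTree-loopless base {zero}     ()
twoTree-loopless base {suc zero} ()
twoTree-loopless (extend t _ _ _) {suc x} a = twoTree-loopless t a
twoTree-loopless (relabel t _ _ H≡) {x} a = twoTree-loopless t (subst T (H≡ x x) a)

BetweenPowers : ℕ → ℕ → Set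
BetweenPowers n τ = 2 ^ (n ∸ 2) ≤ τ × τ ≤ 3 ^ (n ∸ 2)

betweenPowers-addVertex : {G : Graph n} {u v : Fin n} → 2 ≤ n → Symmetric (Adj G) → Adj G u v → u ≢ v →
  BetweenPowers n (numSpanningTrees G) → BetweenPowers (suc n) (numSpanningTrees (addVertex G u v))
betweenPowers-addVertex {G = G} (s≤s (s≤s _)) G-sym uv u≢v (lower , upper) =
  ≤-trans (*-monoʳ-≤ 2 lower) (numSpanningTrees-addVertex≥ {G = G} u≢v) ,
  ≤-trans (numSpanningTrees-addVertex≤ {G = G} G-sym uv) (*-monoʳ-≤ 3 upper)

twoTree-betweenPowers : {G : Graph n} → TwoTree n G → BetweenPowers n (numSpanningTrees G)
twoTree-betweenPowers base = s≤s z≤n , s≤s z≤n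
twoTree-betweenPowers (extend {G = G} t u v uv) =
  betweenPowers-addVertex (twoTree-order t) (twoTree-symmetric t) adj (λ { refl → twoTree-loopless t adj })
    (twoTree-betweenPowers t)
  where
  adj : Adj G u v
  adj = Equivalence.from T-≡ uv
twoTree-betweenPowers (relabel {zero} t _ _ _) with () ← twoTree-order t
twoTree-betweenPowers (relabel {suc m} {G} t H σ H≡) =
  subst (BetweenPowers (suc m)) (sym (numSpanningTrees-relabel {G = G} {H} (twoTree-symmetric t) σ H≡))
    (twoTree-betweenPowers t)

theorem3p1 : (n : ℕ) → 2 ≤ n → (G : Graph n) → TwoTree n G →
    (2 ^ (n ∸ 2) ≤ numSpanningTrees G) × (numSpanningTrees G ≤ 3 ^ (n ∸ 2))
theorem3p1 n _ G = twoTree-betweenPowers
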